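{- For every integer $d\geq3$ there exist subsets $S_1^d,S_2^d,S_3^d$ of $V(Q_d)$ such that (a) $S_1^d\subseteq S_2^d\subseteq S_3^d$; (b) $|S_1^d|=1$; (c) $|S_2^d|=\lceil d/2\rceil+1$; (d) $|S_3^d|=\left\lceil\frac{d(d+3)}{6}\right\rceil+1$; and (e) $S_i^d$ percolates with respect to the $i$-neighbour bootstrap process on $Q_d$ for each $i\in\{1,2,3\}$.
   Context: $Q_d$ denotes the $d$-dimensional hypercube: vertex set $\{0,1\}^d$, two vertices adjacent iff they differ in exactly one coordinate. For $r\geq1$, the $r$-neighbour bootstrap process on a graph $G$ starts with a set $A_0\subseteq V(G)$ and sets $A_t:=A_{t-1}\cup\{v: |N_G(v)\cap A_{t-1}|\geq r\}$ for $t\geq1$; $A_0$ percolates if $\bigcup_t A_t=V(G)$. -}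

module Defs where

open import Data.Nat using (ℕ; zero; suc; _+_; _*_; _≤ᵇ_; _/_; _≤_)
open import Data.Bool using (Bool; true; false; not; _∨_)
open import Data.Fin using (Fin)
open import Data.Vec using (Vec; updateAt; lookup)
open import Data.List using (List; filter; length; allFin)
open import Data.Bool.ListAction using (any)
open import Data.List.Relation.Unary.Any using (Any)
open import Relation.Binary.PropositionalEquality using (_≡_)
open import Relation.Nullary.Decidable using (does; Dec)
open import Data.Vec.Properties using (≡-dec)
open import Data.Bool.Properties using () renaming (_≟_ to _≟B_)
open import Data.Product using (∃)
open import Relation.Unary using (Pred)
open import Level using (0ℓ)

Vertex : ℕ → Set
Vertex d = Vec Bool d

_≟V_ : ∀ {d} (u v : Vertex d) → Dec (u ≡ v)
_≟V_ = ≡-dec _≟B_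

-- flip coordinate i; the neighbours of v in Q_d are exactly flip i v for i : Fin d
-- (pairwise distinct), so this enumerates N(v) without repetition.
flip : ∀ {d} → Fin d → Vertex d → Vertex d
flip i v = updateAt v i not

-- a vertex set, as a Boolean-valued indicator (needed to iterate the process)
VSet : ℕ → Set
VSet d = Vertex d → Bool

nbrCount : ∀ {d} → VSet d → Vertex d → ℕ
nbrCount {d} A v = length (filter (λ i → A (flip i v) ≟B true) (allFin d))

step : ∀ {d} → ℕ → VSet d → VSet d
step r A v = A v ∨ (r ≤ᵇ nbrCount A v)

bootstrap : ∀ {d} → ℕ → VSet d → ℕ → VSet d
bootstrap r A zero = A
bootstrap r A (suc t) = step r (bootstrap r A t)

toVSet : ∀ {d} → List (Vertex d) → VSet d
toVSet S v = any (λ u → does (u ≟V v)) S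

-- A_0 percolates: ⋃_t A_t = V(Q_d). Since A_t is increasing and V(Q_d) finite,
-- this is equivalent to every vertex lying in some A_t.
Percolates : ∀ {d} → ℕ → VSet d → Set
Percolates {d} r A = (v : Vertex d) → ∃ λ t → bootstrap r A t v ≡ true

-- Bootstrap percolation is monotone and commutes with embeddings of faces, so if A spans a
-- seed placed on a face of the cube, it spans everything that seed spans inside the face. S₂ in dimension n + 6 is a copy of S₂ in dimension n on the face
-- {0⁶} × Qₙ plus three vertices, and S₃ in dimension d + 3 is a copy of S₃ in dimension d on
-- {0³} × Q_d plus a set E of d + 3 vertices, matching ⌈(d+3)(d+6)/6⌉ = ⌈d(d+3)/6⌉ + d + 3.
-- That {0³} × Q_d together with E percolates is proved in steps d ↦ d + 2, inserting two
-- coordinates and two vertices. All percolation arguments sweep a product Qₖ × Qₙ fibre by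
-- fibre, in order of weight in Qₙ; the finitely many configurations in dimension at most 7
-- that this leaves are checked by running the process.
module Submission where

open import Defs
open import Data.Nat using (ℕ; zero; suc; _+_; _*_; _^_; _/_; _≤_; z≤n; s≤s; NonZero)
open import Data.Nat.Properties using (≤ᵇ⇒≤; ≤⇒≤ᵇ; ≤-refl; ≤-trans; +-mono-≤; +-monoʳ-≤; m≤n+m; +-comm; +-assoc)
open import Data.Nat.DivMod using (+-distrib-/-∣ʳ; m*n/n≡m)
open import Data.Nat.Divisibility using (divides)
open import Data.Nat.Tactic.RingSolver using (solve-∀)
open import Data.Bool using (Bool; true; false; not; _∨_; _∧_)
open import Data.Bool.Properties using (∨-zeroʳ; T-≡; not-¬) renaming (_≟_ to _≟B_)
open import Data.Fin using (Fin; zero; suc; #_)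
open import Data.Vec using (Vec; []; _∷_; lookup; replicate; _++_; splitAt; take)
open import Data.Vec.Properties using (∷-injectiveˡ; ∷-injectiveʳ; ++-injectiveˡ; ++-injectiveʳ)
open import Data.List using (List; []; _∷_; filter; length; tabulate; map) renaming (_++_ to _++ˡ_)
open import Data.List.Properties using (length-++; length-map)
open import Data.List.Membership.Propositional using (_∈_)
open import Data.List.Membership.Propositional.Properties using (∈-++⁺ˡ; ∈-++⁺ʳ; ∈-++⁻; ∈-map⁺; ∈-map⁻)
open import Data.List.Relation.Unary.Any using (here; there)
open import Data.List.Relation.Unary.All as All using (All; []; _∷_)
import Data.List.Relation.Unary.All.Properties as All
open import Data.List.Relation.Unary.AllPairs using ([]; _∷_)
open import Data.List.Relation.Unary.Unique.Propositional using (Unique)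
open import Data.List.Relation.Unary.Unique.Propositional.Properties using (++⁺; map⁺)
import Data.List.Relation.Unary.Unique.DecPropositional as DecUnique
open import Data.List.Relation.Binary.Disjoint.Propositional using (Disjoint)
open import Data.List.Relation.Binary.Subset.Propositional using (_⊆_)
import Data.List.Relation.Binary.Subset.DecPropositional as DecSubset
open import Data.Product using (Σ; ∃; _×_; _,_)
open import Data.Sum using (_⊎_; inj₁; inj₂)
open import Function using (_∘_; id)
open import Function.Bundles using (module Equivalence)
open import Relation.Binary.PropositionalEquality using (_≡_; refl; sym; trans; cong; cong₂; subst; module ≡-Reasoning)
open import Relation.Nullary.Decidable using (Dec; does; yes; no; dec-true; from-yes)

open Equivalence using (from; to)

∨-introˡ : ∀ {a} b → a ≡ true → a ∨ b ≡ true
∨-introˡ b refl = refl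

∨-introʳ : ∀ a {b} → b ≡ true → a ∨ b ≡ true
∨-introʳ a refl = ∨-zeroʳ a

∨-elim : ∀ a {b} → a ∨ b ≡ true → a ≡ true ⊎ b ≡ true
∨-elim true  _ = inj₁ refl
∨-elim false h = inj₂ h

bit : Bool → ℕ
bit false = 0
bit true  = 1

trues : ∀ {n} → (Fin n → Bool) → ℕ
trues {zero}  f = 0
trues {suc n} f = bit (f zero) + trues (f ∘ suc)

trues-mono : ∀ {n} (f g : Fin n → Bool) → (∀ i → f i ≡ true → g i ≡ true) → trues f ≤ trues g
trues-mono {zero}  f g f⇒g = z≤n
trues-mono {suc n} f g f⇒g = +-mono-≤ (bit-mono (f zero) (f⇒g zero)) (trues-mono _ _ (f⇒g ∘ suc))
  where
  bit-mono : ∀ a {b} → (a ≡ true → b ≡ true) → bit a ≤ bit b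
  bit-mono false _ = z≤n
  bit-mono true  h rewrite h refl = ≤-refl

length-filter-tabulate : ∀ {m} n (g : Fin n → Fin m) (f : Fin m → Bool) →
  length (filter (λ i → f i ≟B true) (tabulate g)) ≡ trues (f ∘ g)
length-filter-tabulate zero    g f = refl
length-filter-tabulate (suc n) g f with f (g zero) | length-filter-tabulate n (g ∘ suc) f
... | true  | ih = cong suc ih
... | false | ih = ih

infix 4 _⊆ᵛ_
_⊆ᵛ_ : ∀ {d} → VSet d → VSet d → Set
A ⊆ᵛ B = ∀ v → A v ≡ true → B v ≡ true

degIn : ∀ {d} → VSet d → Vertex d → ℕ
degIn A v = trues (λ i → A (flip i v))

nbrCount≡degIn : ∀ {d} (A : VSet d) v → nbrCount A v ≡ degIn A v
nbrCount≡degIn {d} A v = length-filter-tabulate d id (λ i → A (flip i v))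

degIn-mono : ∀ {d} {A B : VSet d} → A ⊆ᵛ B → ∀ v → degIn A v ≤ degIn B v
degIn-mono A⊆B v = trues-mono _ _ (λ i → A⊆B (flip i v))

step-extensive : ∀ {d} r (A : VSet d) → A ⊆ᵛ step r A
step-extensive r A v = ∨-introˡ _

step-threshold : ∀ {d} r (A : VSet d) v → r ≤ degIn A v → step r A v ≡ true
step-threshold r A v r≤ =
  ∨-introʳ (A v) (T-≡ .to (≤⇒≤ᵇ (subst (r ≤_) (sym (nbrCount≡degIn A v)) r≤)))

step-inv : ∀ {d} r (A : VSet d) v → step r A v ≡ true → A v ≡ true ⊎ r ≤ degIn A v
step-inv r A v h with ∨-elim (A v) h
... | inj₁ Av = inj₁ Av
... | inj₂ r≤ = inj₂ (subst (r ≤_) (nbrCount≡degIn A v) (≤ᵇ⇒≤ r _ (T-≡ .from r≤)))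

-- Faces of the cube

data Face : ℕ → ℕ → Set where
  cube  : ∀ {n} → Face n n
  fixed : ∀ {n k} → Bool → Face n k → Face (suc n) k
  free  : ∀ {n k} → Face n k → Face (suc n) (suc k)

embed : ∀ {n k} → Face n k → Vertex k → Vertex n
embed cube        u       = u
embed (fixed b F) u       = b ∷ embed F u
embed (free F)    (c ∷ u) = c ∷ embed F u

degIn-embed : ∀ {n k} (F : Face n k) (A : VSet n) u → degIn (A ∘ embed F) u ≤ degIn A (embed F u)
degIn-embed cube        A u       = ≤-refl
degIn-embed (fixed b F) A u       = ≤-trans (degIn-embed F (A ∘ (b ∷_)) u) (m≤n+m _ _)
degIn-embed (free F)    A (c ∷ u) = +-monoʳ-≤ (bit (A (not c ∷ embed F u))) (degIn-embed F (A ∘ (c ∷_)) u)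

step-face : ∀ {n k} r (F : Face n k) {B : VSet k} {C : VSet n} →
  B ⊆ᵛ C ∘ embed F → step r B ⊆ᵛ step r C ∘ embed F
step-face r F {B} {C} B⊆C u h with step-inv r B u h
... | inj₁ Bu = step-extensive r C (embed F u) (B⊆C u Bu)
... | inj₂ r≤ = step-threshold r C (embed F u) (≤-trans r≤ (≤-trans (degIn-mono B⊆C u) (degIn-embed F C u)))

bootstrap-face : ∀ {n k} r (F : Face n k) {B : VSet k} {C : VSet n} →
  B ⊆ᵛ C ∘ embed F → ∀ t → bootstrap r B t ⊆ᵛ bootstrap r C t ∘ embed F
bootstrap-face r F         B⊆C zero    = B⊆C
bootstrap-face r F {B} {C} B⊆C (suc t) =
  step-face r F {bootstrap r B t} {bootstrap r C t} (bootstrap-face r F B⊆C t)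

bootstrap-increasing : ∀ {d} r (A : VSet d) s t → bootstrap r A t ⊆ᵛ bootstrap r A (s + t)
bootstrap-increasing r A zero    t v h = h
bootstrap-increasing r A (suc s) t v h = step-extensive r (bootstrap r A (s + t)) v (bootstrap-increasing r A s t v h)

bootstrap-+ : ∀ {d} r (A : VSet d) s t → bootstrap r (bootstrap r A s) t ≡ bootstrap r A (t + s)
bootstrap-+ r A s zero    = refl
bootstrap-+ r A s (suc t) = cong (step r) (bootstrap-+ r A s t)

Spans : ∀ {d} → ℕ → VSet d → Vertex d → Set
Spans r A v = ∃ λ t → bootstrap r A t v ≡ true

initially : ∀ {d r} {A : VSet d} {v} → A v ≡ true → Spans r A v
initially Av = 0 , Av

uniform-time : ∀ k (P : ℕ → Vertex k → Set) → (∀ s t v → P t v → P (s + t) v) →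
  (∀ v → ∃ λ t → P t v) → ∃ λ T → ∀ v → P T v
uniform-time zero P mono eventually with eventually []
... | t , p = t , λ { [] → p }
uniform-time (suc k) P mono eventually
  with uniform-time k (λ t w → P t (false ∷ w)) (λ s t w → mono s t (false ∷ w)) (eventually ∘ (false ∷_))
     | uniform-time k (λ t w → P t (true ∷ w)) (λ s t w → mono s t (true ∷ w)) (eventually ∘ (true ∷_))
... | T₀ , p₀ | T₁ , p₁ = T₁ + T₀ , λ
  { (false ∷ w) → mono T₁ T₀ _ (p₀ w)
  ; (true ∷ w)  → subst (λ T → P T (true ∷ w)) (+-comm T₀ T₁) (mono T₀ T₁ _ (p₁ w)) }

spans-face : ∀ {n k} r (F : Face n k) {A : VSet n} {C : VSet k} →
  (∀ u → C u ≡ true → Spans r A (embed F u)) → ∀ u → Spans r C u → Spans r A (embed F u)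
spans-face {k = k} r F {A} {C} C⊆A u (t , Ctu)
  with uniform-time k (λ T u → C u ≡ true → bootstrap r A T (embed F u) ≡ true)
         (λ s T v h Cv → bootstrap-increasing r A s T (embed F v) (h Cv)) eventually
  where
  eventually : ∀ v → ∃ λ T → C v ≡ true → bootstrap r A T (embed F v) ≡ true
  eventually v with C v in Cv
  ... | true  = let (T , h) = C⊆A v Cv in T , λ _ → h
  ... | false = 0 , λ ()
... | T , C⊆A[T] = t + T , subst (λ X → X (embed F u) ≡ true) (bootstrap-+ r A T t)
                              (bootstrap-face r F C⊆A[T] t u Ctu)

percolates-face : ∀ {n k} r (F : Face n k) {A : VSet n} {C : VSet k} →
  (∀ u → C u ≡ true → Spans r A (embed F u)) → Percolates r C → ∀ u → Spans r A (embed F u)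
percolates-face r F C⊆A percC u = spans-face r F C⊆A u (percC u)

-- Percolation by evaluation

data Table : ℕ → Set where
  leaf : Bool → Table 0
  node : ∀ {k} → Table k → Table k → Table (suc k)

tabulateᵀ : ∀ {k} → VSet k → Table k
tabulateᵀ {zero}  A = leaf (A [])
tabulateᵀ {suc k} A = node (tabulateᵀ (A ∘ (false ∷_))) (tabulateᵀ (A ∘ (true ∷_)))

lookupᵀ : ∀ {k} → Table k → VSet k
lookupᵀ (leaf b)   []          = b
lookupᵀ (node l r) (false ∷ v) = lookupᵀ l v
lookupᵀ (node l r) (true ∷ v)  = lookupᵀ r v

lookup-tabulateᵀ : ∀ {k} (A : VSet k) v → lookupᵀ (tabulateᵀ A) v ≡ A v
lookup-tabulateᵀ A []          = refl
lookup-tabulateᵀ A (false ∷ v) = lookup-tabulateᵀ (A ∘ (false ∷_)) v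
lookup-tabulateᵀ A (true ∷ v)  = lookup-tabulateᵀ (A ∘ (true ∷_)) v

allTrue : ∀ {k} → Table k → Bool
allTrue (leaf b)   = b
allTrue (node l r) = allTrue l ∧ allTrue r

allTrue-lookup : ∀ {k} (X : Table k) → allTrue X ≡ true → ∀ v → lookupᵀ X v ≡ true
allTrue-lookup (leaf b)   h []          = h
allTrue-lookup (node l r) h (false ∷ v) with allTrue l in hl
... | true = allTrue-lookup l hl v
allTrue-lookup (node l r) h (true ∷ v)  with allTrue l
... | true = allTrue-lookup r h v

-- Tabulating each stage lets the evaluator share it between the k + 1 lookups made by the
-- next stage; unfolding bootstrap itself costs (k + 1) ^ t.
bootstrapᵀ : ∀ {k} → ℕ → VSet k → ℕ → Table k
bootstrapᵀ r A zero    = tabulateᵀ A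
bootstrapᵀ r A (suc t) = tabulateᵀ (step r (lookupᵀ (bootstrapᵀ r A t)))

bootstrapᵀ-sound : ∀ {k} r (A : VSet k) t → lookupᵀ (bootstrapᵀ r A t) ⊆ᵛ bootstrap r A t
bootstrapᵀ-sound r A zero v h = trans (sym (lookup-tabulateᵀ A v)) h
bootstrapᵀ-sound r A (suc t) v h =
  step-face r cube {lookupᵀ (bootstrapᵀ r A t)} {bootstrap r A t} (bootstrapᵀ-sound r A t) v
    (trans (sym (lookup-tabulateᵀ (step r (lookupᵀ (bootstrapᵀ r A t))) v)) h)

-- 2 ^ k rounds always suffice: every round before the process stabilises infects a vertex.
percolates-by-evaluation : ∀ {k} r (A : VSet k) → allTrue (bootstrapᵀ r A (2 ^ k)) ≡ true → Percolates r A
percolates-by-evaluation {k} r A h v =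
  2 ^ k , bootstrapᵀ-sound r A (2 ^ k) v (allTrue-lookup (bootstrapᵀ r A (2 ^ k)) h v)

∈⇒toVSet : ∀ {d} {v : Vertex d} {S} → v ∈ S → toVSet S v ≡ true
∈⇒toVSet {v = v} (here refl) = ∨-introˡ _ (dec-true (v ≟V v) refl)
∈⇒toVSet {S = u ∷ S} (there v∈S) = ∨-introʳ (does (u ≟V _)) (∈⇒toVSet v∈S)

toVSet⇒∈ : ∀ {d} (v : Vertex d) S → toVSet S v ≡ true → v ∈ S
toVSet⇒∈ v (u ∷ S) h with u ≟V v
... | yes refl = here refl
... | no _     = there (toVSet⇒∈ v S h)

-- Sweeping a product Q_k × Q_n

zeros : ∀ n → Vertex n
zeros n = replicate n false

weight-induction : ∀ {n} (P : Vertex n → Set) → P (zeros n) →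
  (∀ w j → lookup w j ≡ true → P (flip j w) → P w) → ∀ w → P w
weight-induction {zero}  P P0 climb []      = P0
weight-induction {suc n} P P0 climb (b ∷ w) = lift b
  where
  P[0w] : P (false ∷ w)
  P[0w] = weight-induction (P ∘ (false ∷_)) P0 (λ w j → climb (false ∷ w) (suc j)) w
  lift : ∀ b → P (b ∷ w)
  lift false = P[0w]
  lift true  = climb (true ∷ w) zero refl P[0w]

prefix : ∀ {k n} → Vertex k → Face (k + n) n
prefix []      = cube
prefix (b ∷ x) = fixed b (prefix x)

point : ∀ {n} → Vertex n → Face n 0
point []      = cube
point (b ∷ w) = fixed b (point w)

line : ∀ {n} → Vertex n → Fin n → Face n 1
line (b ∷ w) zero    = free (point w)
line (b ∷ w) (suc j) = fixed b (line w j)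

fibre : ∀ {k n} → Vertex n → Face (k + n) k
fibre {zero}  w = point w
fibre {suc k} w = free (fibre w)

widen : ∀ k {n m} → Face n m → Face (k + n) (k + m)
widen zero    F = F
widen (suc k) F = free (widen k F)

embed-point : ∀ {n} (w : Vertex n) → embed (point w) [] ≡ w
embed-point []      = refl
embed-point (b ∷ w) = cong (b ∷_) (embed-point w)

embed-line-true : ∀ {n} (w : Vertex n) j → lookup w j ≡ true → embed (line w j) (true ∷ []) ≡ w
embed-line-true (b ∷ w) zero    refl = cong (true ∷_) (embed-point w)
embed-line-true (b ∷ w) (suc j) wj   = cong (b ∷_) (embed-line-true w j wj)

embed-line-false : ∀ {n} (w : Vertex n) j → lookup w j ≡ true → embed (line w j) (false ∷ []) ≡ flip j w
embed-line-false (b ∷ w) zero    refl = cong (false ∷_) (embed-point w)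
embed-line-false (b ∷ w) (suc j) wj   = cong (b ∷_) (embed-line-false w j wj)

embed-fibre : ∀ {k n} (x : Vertex k) (w : Vertex n) → embed (fibre w) x ≡ x ++ w
embed-fibre []      w = embed-point w
embed-fibre (c ∷ x) w = cong (c ∷_) (embed-fibre x w)

embed-widen : ∀ {k n m} (F : Face n m) (x : Vertex k) u → embed (widen k F) (x ++ u) ≡ x ++ embed F u
embed-widen F []      u = refl
embed-widen F (c ∷ x) u = cong (c ∷_) (embed-widen F x u)

-- (Q_k × {0}) ∪ (K × {1}), the last coordinate being the Q_1 factor.
prismSeed : ∀ {k} → VSet k → VSet (k + 1)
prismSeed {zero}  K (b ∷ []) = not b ∨ K []
prismSeed {suc k} K (c ∷ u)  = prismSeed (K ∘ (c ∷_)) u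

prismSeed-++ : ∀ {k} (K : VSet k) x b → prismSeed K (x ++ (b ∷ [])) ≡ not b ∨ K x
prismSeed-++ K []      b = refl
prismSeed-++ K (c ∷ x) b = prismSeed-++ (K ∘ (c ∷_)) x b

-- By induction on the weight of w, the fibre Q_k × {w} is
-- spanned inside the (k+1)-dimensional face Q_k × {w', w}, w' = w with one 1 flipped, from the
-- fibre over w' together with K × {w}.
sweep : ∀ {k n} r (A : VSet (k + n)) (B K : VSet k) →
  Percolates r B → (∀ x → B x ≡ true → Spans r A (x ++ zeros n)) →
  Percolates r (prismSeed K) → (∀ x w → K x ≡ true → Spans r A (x ++ w)) →
  Percolates r A
sweep {k} {n} r A B K percB B⊆A percK K⊆A v with splitAt k v
... | x , w , refl = weight-induction (λ w → ∀ x → Spans r A (x ++ w)) base climb w x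
  where
  base : ∀ x → Spans r A (x ++ zeros n)
  base x = subst (Spans r A) (embed-fibre x (zeros n))
    (percolates-face r (fibre (zeros n))
      (λ u Bu → subst (Spans r A) (sym (embed-fibre u (zeros n))) (B⊆A u Bu)) percB x)

  climb : ∀ w j → lookup w j ≡ true → (∀ x → Spans r A (x ++ flip j w)) → ∀ x → Spans r A (x ++ w)
  climb w j wj below x = subst (Spans r A) (trans (embed-widen L x _) (cong (x ++_) (embed-line-true w j wj)))
    (percolates-face r (widen k L) seed⊆A percK (x ++ (true ∷ [])))
    where
    L = line w j
    onLine : ∀ y b → not b ∨ K y ≡ true → Spans r A (y ++ embed L (b ∷ []))
    onLine y false _  = subst (Spans r A) (cong (y ++_) (sym (embed-line-false w j wj))) (below y)
    onLine y true  Ky = subst (Spans r A) (cong (y ++_) (sym (embed-line-true w j wj))) (K⊆A y w Ky)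
    seed⊆A : ∀ u → prismSeed K u ≡ true → Spans r A (embed (widen k L) u)
    seed⊆A u h with splitAt k u
    ... | y , b ∷ [] , refl = subst (Spans r A) (sym (embed-widen L y (b ∷ [])))
                                (onLine y b (trans (sym (prismSeed-++ K y b)) h))

zeros-percolates₁ : ∀ n → Percolates 1 (toVSet (zeros n ∷ []))
zeros-percolates₁ n =
  sweep {0} 1 _ (λ _ → true) (λ _ → false)
    (percolates-by-evaluation 1 _ refl) (λ { [] _ → initially (∈⇒toVSet {S = zeros n ∷ []} (here refl)) })
    (percolates-by-evaluation 1 _ refl) (λ _ _ ())

-- The 2-neighbour sets

pattern O = false
pattern I = true

extra₂ : List (Vertex 6)
extra₂ = (O ∷ O ∷ O ∷ O ∷ I ∷ I ∷ []) ∷ (O ∷ I ∷ I ∷ O ∷ O ∷ O ∷ []) ∷ (I ∷ I ∷ O ∷ I ∷ I ∷ O ∷ []) ∷ []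

extend₂ : ∀ {n} → List (Vertex n) → List (Vertex (6 + n))
extend₂ {n} S = map (zeros 6 ++_) S ++ˡ map (_++ zeros n) extra₂

∈-extend₂ˡ : ∀ {n} {S : List (Vertex n)} {v} → v ∈ S → zeros 6 ++ v ∈ extend₂ S
∈-extend₂ˡ v∈S = ∈-++⁺ˡ (∈-map⁺ (zeros 6 ++_) v∈S)

∈-extend₂ʳ : ∀ {n} (S : List (Vertex n)) {x} → x ∈ extra₂ → x ++ zeros n ∈ extend₂ S
∈-extend₂ʳ {n} S x∈ = ∈-++⁺ʳ (map (zeros 6 ++_) S) (∈-map⁺ (_++ zeros n) x∈)

-- S₂ 6 and S₂ 7 are not extend₂ (S₂ 0) and extend₂ (S₂ 1), which do not lie inside S₃ 3 and S₃ 4.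
S₂ : ∀ n → List (Vertex n)
S₂ 0 = [] ∷ []
S₂ 1 = (O ∷ []) ∷ (I ∷ []) ∷ []
S₂ 2 = (O ∷ O ∷ []) ∷ (I ∷ I ∷ []) ∷ []
S₂ 3 = (O ∷ O ∷ O ∷ []) ∷ (O ∷ I ∷ I ∷ []) ∷ (I ∷ O ∷ I ∷ []) ∷ []
S₂ 4 = (O ∷ O ∷ O ∷ O ∷ []) ∷ (O ∷ O ∷ I ∷ I ∷ []) ∷ (I ∷ I ∷ O ∷ O ∷ []) ∷ []
S₂ 5 = (O ∷ O ∷ O ∷ O ∷ O ∷ []) ∷ (O ∷ O ∷ O ∷ I ∷ I ∷ []) ∷ (O ∷ I ∷ I ∷ O ∷ O ∷ [])
     ∷ (I ∷ I ∷ O ∷ O ∷ O ∷ []) ∷ []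
S₂ 6 = (O ∷ O ∷ O ∷ O ∷ O ∷ O ∷ []) ∷ (O ∷ O ∷ O ∷ O ∷ I ∷ I ∷ []) ∷ (O ∷ I ∷ I ∷ O ∷ O ∷ O ∷ [])
     ∷ (I ∷ I ∷ O ∷ I ∷ O ∷ O ∷ []) ∷ []
S₂ 7 = (O ∷ O ∷ O ∷ O ∷ O ∷ O ∷ O ∷ []) ∷ (O ∷ O ∷ O ∷ O ∷ O ∷ I ∷ I ∷ []) ∷ (O ∷ O ∷ O ∷ I ∷ I ∷ O ∷ O ∷ [])
     ∷ (O ∷ I ∷ I ∷ O ∷ O ∷ O ∷ O ∷ []) ∷ (I ∷ O ∷ I ∷ O ∷ O ∷ O ∷ O ∷ []) ∷ []
S₂ (suc (suc (suc (suc (suc (suc (suc (suc n)))))))) = extend₂ (S₂ (suc (suc n)))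

zeros∈S₂ : ∀ n → zeros n ∈ S₂ n
zeros∈S₂ 0 = here refl
zeros∈S₂ 1 = here refl
zeros∈S₂ 2 = here refl
zeros∈S₂ 3 = here refl
zeros∈S₂ 4 = here refl
zeros∈S₂ 5 = here refl
zeros∈S₂ 6 = here refl
zeros∈S₂ 7 = here refl
zeros∈S₂ (suc (suc (suc (suc (suc (suc (suc (suc n)))))))) = ∈-extend₂ˡ (zeros∈S₂ (suc (suc n)))

extend₂-percolates : ∀ {n} (S : List (Vertex n)) → zeros n ∈ S → Percolates 2 (toVSet S) →
  Percolates 2 (toVSet (extend₂ S))
extend₂-percolates {n} S zeros∈S percS =
  sweep 2 A (toVSet (zeros 6 ∷ extra₂)) (toVSet (zeros 6 ∷ []))
    (percolates-by-evaluation 2 _ refl) base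
    (percolates-by-evaluation 2 _ refl) zeros₆-fibre
  where
  A = toVSet (extend₂ S)
  base : ∀ x → toVSet (zeros 6 ∷ extra₂) x ≡ true → Spans 2 A (x ++ zeros n)
  base x h with toVSet⇒∈ x (zeros 6 ∷ extra₂) h
  ... | here refl = initially (∈⇒toVSet (∈-extend₂ˡ zeros∈S))
  ... | there x∈  = initially (∈⇒toVSet (∈-extend₂ʳ S x∈))
  zeros₆-fibre : ∀ x w → toVSet (zeros 6 ∷ []) x ≡ true → Spans 2 A (x ++ w)
  zeros₆-fibre x w h with toVSet⇒∈ x (zeros 6 ∷ []) h
  ... | here refl = percolates-face 2 (prefix (zeros 6))
                      (λ u h → initially (∈⇒toVSet (∈-extend₂ˡ (toVSet⇒∈ u S h)))) percS w

S₂-percolates : ∀ n → Percolates 2 (toVSet (S₂ n))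
S₂-percolates 0 = percolates-by-evaluation 2 _ refl
S₂-percolates 1 = percolates-by-evaluation 2 _ refl
S₂-percolates 2 = percolates-by-evaluation 2 _ refl
S₂-percolates 3 = percolates-by-evaluation 2 _ refl
S₂-percolates 4 = percolates-by-evaluation 2 _ refl
S₂-percolates 5 = percolates-by-evaluation 2 _ refl
S₂-percolates 6 = percolates-by-evaluation 2 _ refl
S₂-percolates 7 = percolates-by-evaluation 2 _ refl
S₂-percolates (suc (suc (suc (suc (suc (suc (suc (suc n)))))))) =
  extend₂-percolates (S₂ (2 + n)) (zeros∈S₂ (2 + n)) (S₂-percolates (suc (suc n)))

-- The 3-neighbour sets

onFloor : ∀ {n} → Vertex (3 + n) → Bool
onFloor (x ∷ y ∷ z ∷ _) = not (x ∨ y ∨ z)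

zeros₃₄ : ∀ {m} → Face (8 + m) (6 + m)
zeros₃₄ = free (free (free (fixed O (fixed O cube))))

extra₃ : List (Vertex 5)
extra₃ = (I ∷ I ∷ O ∷ I ∷ I ∷ []) ∷ (I ∷ O ∷ I ∷ I ∷ I ∷ []) ∷ []

E : ∀ m → List (Vertex (6 + m))
E 0 = (O ∷ I ∷ I ∷ O ∷ O ∷ O ∷ []) ∷ (I ∷ O ∷ I ∷ O ∷ O ∷ O ∷ []) ∷ (I ∷ I ∷ O ∷ I ∷ O ∷ O ∷ [])
    ∷ (I ∷ I ∷ O ∷ O ∷ I ∷ O ∷ []) ∷ (I ∷ I ∷ I ∷ O ∷ O ∷ I ∷ []) ∷ (O ∷ I ∷ I ∷ I ∷ I ∷ I ∷ []) ∷ []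
E 1 = (O ∷ I ∷ I ∷ O ∷ O ∷ O ∷ O ∷ []) ∷ (I ∷ O ∷ I ∷ O ∷ O ∷ O ∷ O ∷ []) ∷ (I ∷ I ∷ O ∷ O ∷ O ∷ O ∷ O ∷ [])
    ∷ (I ∷ I ∷ O ∷ O ∷ O ∷ I ∷ I ∷ []) ∷ (I ∷ O ∷ I ∷ O ∷ O ∷ I ∷ I ∷ []) ∷ (I ∷ I ∷ O ∷ I ∷ I ∷ O ∷ O ∷ [])
    ∷ (I ∷ O ∷ I ∷ I ∷ I ∷ O ∷ O ∷ []) ∷ []
E (suc (suc m)) = map (embed zeros₃₄) (E m) ++ˡ map (_++ zeros (3 + m)) extra₃

E-has-011 : ∀ m → (O ∷ I ∷ I ∷ zeros (3 + m)) ∈ E m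
E-has-011 0 = here refl
E-has-011 1 = here refl
E-has-011 (suc (suc m)) = ∈-++⁺ˡ (∈-map⁺ (embed zeros₃₄) (E-has-011 m))

floorSeed : ∀ m → VSet (6 + m)
floorSeed m v = onFloor v ∨ toVSet (E m) v

floorSeed-zeros₃₄ : ∀ m u → floorSeed m u ≡ true → floorSeed (2 + m) (embed zeros₃₄ u) ≡ true
floorSeed-zeros₃₄ m (x ∷ y ∷ z ∷ w) h with not (x ∨ y ∨ z)
... | true  = refl
... | false = ∈⇒toVSet (∈-++⁺ˡ (∈-map⁺ (embed zeros₃₄) (toVSet⇒∈ (x ∷ y ∷ z ∷ w) (E m) h)))

floorSeed-percolates : ∀ m → Percolates 3 (floorSeed m)
floorSeed-percolates 0 = percolates-by-evaluation 3 _ refl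
floorSeed-percolates 1 = percolates-by-evaluation 3 _ refl
floorSeed-percolates (suc (suc m)) =
  sweep 3 A (λ x → K x ∨ toVSet extra₃ x) K
    (percolates-by-evaluation 3 _ refl) base
    (percolates-by-evaluation 3 _ refl) K-fibre
  where
  A = floorSeed (2 + m)
  K : VSet 5
  K (x ∷ y ∷ z ∷ a ∷ b ∷ []) = not (a ∨ b) ∨ not (x ∨ y ∨ z)
  face₃₄ : ∀ u → Spans 3 A (embed zeros₃₄ u)
  face₃₄ = percolates-face 3 zeros₃₄ (λ u h → initially (floorSeed-zeros₃₄ m u h)) (floorSeed-percolates m)
  K-fibre : ∀ x w → K x ≡ true → Spans 3 A (x ++ w)
  K-fibre (x ∷ y ∷ z ∷ O ∷ O ∷ []) w _ = face₃₄ (x ∷ y ∷ z ∷ w)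
  K-fibre (x ∷ y ∷ z ∷ O ∷ I ∷ []) w h = initially (∨-introˡ _ h)
  K-fibre (x ∷ y ∷ z ∷ I ∷ b ∷ []) w h = initially (∨-introˡ _ h)
  base : ∀ x → K x ∨ toVSet extra₃ x ≡ true → Spans 3 A (x ++ zeros (3 + m))
  base x h with ∨-elim (K x) h
  ... | inj₁ Kx = K-fibre x _ Kx
  ... | inj₂ x∈ = initially (∨-introʳ (onFloor (x ++ zeros (3 + m)))
                    (∈⇒toVSet (∈-++⁺ʳ (map (embed zeros₃₄) (E m)) (∈-map⁺ (_++ zeros (3 + m)) (toVSet⇒∈ x extra₃ x∈)))))

extend₃ : ∀ {m} → List (Vertex (3 + m)) → List (Vertex (6 + m))
extend₃ {m} S = map (zeros 3 ++_) S ++ˡ E m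

∈-extend₃ˡ : ∀ {m} {S : List (Vertex (3 + m))} {v} → v ∈ S → zeros 3 ++ v ∈ extend₃ S
∈-extend₃ˡ v∈S = ∈-++⁺ˡ (∈-map⁺ (zeros 3 ++_) v∈S)

∈-extend₃ʳ : ∀ {m} (S : List (Vertex (3 + m))) {v} → v ∈ E m → v ∈ extend₃ S
∈-extend₃ʳ S = ∈-++⁺ʳ (map (zeros 3 ++_) S)

S₃ : ∀ m → List (Vertex (3 + m))
S₃ 0 = (O ∷ O ∷ O ∷ []) ∷ (O ∷ I ∷ I ∷ []) ∷ (I ∷ O ∷ I ∷ []) ∷ (I ∷ I ∷ O ∷ []) ∷ []
S₃ 1 = (O ∷ O ∷ O ∷ O ∷ []) ∷ (O ∷ O ∷ I ∷ I ∷ []) ∷ (I ∷ I ∷ O ∷ O ∷ []) ∷ (I ∷ I ∷ I ∷ I ∷ [])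
     ∷ (O ∷ I ∷ O ∷ I ∷ []) ∷ (I ∷ O ∷ I ∷ O ∷ []) ∷ []
S₃ 2 = (O ∷ O ∷ O ∷ O ∷ O ∷ []) ∷ (O ∷ O ∷ O ∷ I ∷ I ∷ []) ∷ (O ∷ I ∷ I ∷ O ∷ O ∷ []) ∷ (I ∷ I ∷ O ∷ O ∷ O ∷ [])
     ∷ (I ∷ O ∷ O ∷ I ∷ O ∷ []) ∷ (I ∷ I ∷ I ∷ I ∷ I ∷ []) ∷ (O ∷ I ∷ I ∷ I ∷ O ∷ []) ∷ (I ∷ O ∷ I ∷ O ∷ I ∷ []) ∷ []
S₃ (suc (suc (suc m))) = extend₃ (S₃ m)

extend₃-percolates : ∀ {m} (S : List (Vertex (3 + m))) → Percolates 3 (toVSet S) →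
  Percolates 3 (toVSet (extend₃ S))
extend₃-percolates {m} S percS = percolates-face 3 cube floorSeed⊆A (floorSeed-percolates m)
  where
  A = toVSet (extend₃ S)
  floorSeed⊆A : ∀ v → floorSeed m v ≡ true → Spans 3 A v
  floorSeed⊆A v h with ∨-elim (onFloor v) h
  floorSeed⊆A (O ∷ O ∷ O ∷ w) h | inj₁ _ =
    percolates-face 3 (prefix (zeros 3)) (λ u h → initially (∈⇒toVSet (∈-extend₃ˡ (toVSet⇒∈ u S h)))) percS w
  floorSeed⊆A (O ∷ O ∷ I ∷ w) h | inj₁ ()
  floorSeed⊆A (O ∷ I ∷ _ ∷ w) h | inj₁ ()
  floorSeed⊆A (I ∷ _ ∷ _ ∷ w) h | inj₁ ()
  floorSeed⊆A v h | inj₂ v∈ = initially (∈⇒toVSet (∈-extend₃ʳ S (toVSet⇒∈ v (E m) v∈)))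

S₃-percolates : ∀ m → Percolates 3 (toVSet (S₃ m))
S₃-percolates 0 = percolates-by-evaluation 3 _ refl
S₃-percolates 1 = percolates-by-evaluation 3 _ refl
S₃-percolates 2 = percolates-by-evaluation 3 _ refl
S₃-percolates (suc (suc (suc m))) = extend₃-percolates (S₃ m) (S₃-percolates m)

-- Nesting, sizes and distinctness

_⊆?_ : ∀ {d} (xs ys : List (Vertex d)) → Dec (xs ⊆ ys)
xs ⊆? ys = DecSubset._⊆?_ _≟V_ xs ys

extend₂⊆extend₃² : ∀ {m} {S T : List (Vertex (3 + m))} → S ⊆ T → extend₂ S ⊆ extend₃ (extend₃ T)
extend₂⊆extend₃² {m} {S} {T} S⊆T v∈ with ∈-++⁻ (map (zeros 6 ++_) S) v∈
... | inj₁ v∈ˡ with ∈-map⁻ (zeros 6 ++_) v∈ˡ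
...   | s , s∈S , refl = ∈-extend₃ˡ (∈-extend₃ˡ (S⊆T s∈S))
extend₂⊆extend₃² {m} {S} {T} S⊆T v∈ | inj₂ v∈ʳ with ∈-map⁻ (_++ zeros (3 + m)) {xs = extra₂} v∈ʳ
... | _ , here refl , refl                 = ∈-extend₃ˡ (∈-extend₃ʳ T (E-has-011 m))
... | _ , there (here refl) , refl         = ∈-extend₃ʳ (extend₃ T) (E-has-011 (3 + m))
... | _ , there (there (here refl)) , refl =
  ∈-extend₃ʳ (extend₃ T) (∈-++⁺ʳ (map (embed zeros₃₄) (E (1 + m))) (here refl))

S₂⊆S₃ : ∀ m → S₂ (3 + m) ⊆ S₃ m
S₂⊆S₃ 0 = from-yes (S₂ 3 ⊆? S₃ 0)
S₂⊆S₃ 1 = from-yes (S₂ 4 ⊆? S₃ 1)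
S₂⊆S₃ 2 = from-yes (S₂ 5 ⊆? S₃ 2)
S₂⊆S₃ 3 = from-yes (S₂ 6 ⊆? S₃ 3)
S₂⊆S₃ 4 = from-yes (S₂ 7 ⊆? S₃ 4)
S₂⊆S₃ 5 = from-yes (S₂ 8 ⊆? S₃ 5)
S₂⊆S₃ (suc (suc (suc (suc (suc (suc m)))))) = extend₂⊆extend₃² (S₂⊆S₃ m)

[m+kn]/n≡m/n+k : ∀ m k n .{{_ : NonZero n}} → (m + k * n) / n ≡ m / n + k
[m+kn]/n≡m/n+k m k n = trans (+-distrib-/-∣ʳ m (divides k refl)) (cong (m / n +_) (m*n/n≡m k n))

⌈n/2⌉-step : ∀ n → (n + 1) / 2 + 1 + 3 ≡ (6 + n + 1) / 2 + 1
⌈n/2⌉-step n = begin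
  (n + 1) / 2 + 1 + 3       ≡⟨ +-assoc ((n + 1) / 2) 1 3 ⟩
  (n + 1) / 2 + 4           ≡⟨ +-assoc ((n + 1) / 2) 3 1 ⟨
  (n + 1) / 2 + 3 + 1       ≡⟨ cong (_+ 1) ([m+kn]/n≡m/n+k (n + 1) 3 2) ⟨
  (n + 1 + 3 * 2) / 2 + 1   ≡⟨ cong (λ x → x / 2 + 1) (+-comm (n + 1) 6) ⟩
  (6 + n + 1) / 2 + 1       ∎
  where open ≡-Reasoning

⌈d[d+3]/6⌉-step : ∀ m → ((3 + m) * ((3 + m) + 3) + 5) / 6 + 1 + (6 + m) ≡ ((6 + m) * ((6 + m) + 3) + 5) / 6 + 1
⌈d[d+3]/6⌉-step m = begin
  X / 6 + 1 + (6 + m)         ≡⟨ swap-last (X / 6) 1 (6 + m) ⟩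
  X / 6 + (6 + m) + 1         ≡⟨ cong (_+ 1) ([m+kn]/n≡m/n+k X (6 + m) 6) ⟨
  (X + (6 + m) * 6) / 6 + 1   ≡⟨ cong (λ x → x / 6 + 1) (shift m) ⟩
  ((6 + m) * ((6 + m) + 3) + 5) / 6 + 1 ∎
  where
  open ≡-Reasoning
  X = (3 + m) * ((3 + m) + 3) + 5
  swap-last : ∀ a b c → a + b + c ≡ a + c + b
  swap-last = solve-∀
  shift : ∀ m → (3 + m) * ((3 + m) + 3) + 5 + (6 + m) * 6 ≡ (6 + m) * ((6 + m) + 3) + 5
  shift = solve-∀

length-map-++ : ∀ {A B C : Set} (f : A → C) (g : B → C) xs ys →
  length (map f xs ++ˡ map g ys) ≡ length xs + length ys
length-map-++ f g xs ys = trans (length-++ (map f xs)) (cong₂ _+_ (length-map f xs) (length-map g ys))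

length-S₂ : ∀ n → length (S₂ n) ≡ (n + 1) / 2 + 1
length-S₂ 0 = refl
length-S₂ 1 = refl
length-S₂ 2 = refl
length-S₂ 3 = refl
length-S₂ 4 = refl
length-S₂ 5 = refl
length-S₂ 6 = refl
length-S₂ 7 = refl
length-S₂ (suc (suc (suc (suc (suc (suc (suc (suc n)))))))) = begin
  length (extend₂ (S₂ (2 + n)))   ≡⟨ length-map-++ (zeros 6 ++_) (_++ zeros (2 + n)) (S₂ (2 + n)) extra₂ ⟩
  length (S₂ (2 + n)) + 3         ≡⟨ cong (_+ 3) (length-S₂ (suc (suc n))) ⟩
  (2 + n + 1) / 2 + 1 + 3         ≡⟨ ⌈n/2⌉-step (2 + n) ⟩
  (8 + n + 1) / 2 + 1             ∎
  where open ≡-Reasoning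

length-E : ∀ m → length (E m) ≡ 6 + m
length-E 0 = refl
length-E 1 = refl
length-E (suc (suc m)) = begin
  length (E (2 + m))   ≡⟨ length-map-++ (embed zeros₃₄) (_++ zeros (3 + m)) (E m) extra₃ ⟩
  length (E m) + 2     ≡⟨ cong (_+ 2) (length-E m) ⟩
  6 + m + 2            ≡⟨ +-comm (6 + m) 2 ⟩
  8 + m                ∎
  where open ≡-Reasoning

length-S₃ : ∀ m → length (S₃ m) ≡ ((3 + m) * ((3 + m) + 3) + 5) / 6 + 1
length-S₃ 0 = refl
length-S₃ 1 = refl
length-S₃ 2 = refl
length-S₃ (suc (suc (suc m))) = begin
  length (extend₃ (S₃ m))                          ≡⟨ length-++ (map (zeros 3 ++_) (S₃ m)) ⟩
  length (map (zeros 3 ++_) (S₃ m)) + length (E m) ≡⟨ cong₂ _+_ (length-map (zeros 3 ++_) (S₃ m)) (length-E m) ⟩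
  length (S₃ m) + (6 + m)                          ≡⟨ cong (_+ (6 + m)) (length-S₃ m) ⟩
  ((3 + m) * ((3 + m) + 3) + 5) / 6 + 1 + (6 + m)  ≡⟨ ⌈d[d+3]/6⌉-step m ⟩
  ((6 + m) * ((6 + m) + 3) + 5) / 6 + 1            ∎
  where open ≡-Reasoning

unique? : ∀ {d} (xs : List (Vertex d)) → Dec (Unique xs)
unique? = DecUnique.unique? _≟V_

disjoint-by : ∀ {a} {X : Set a} (f : X → Bool) {b} {xs ys : List X} →
  All (λ x → f x ≡ b) xs → All (λ y → f y ≡ not b) ys → Disjoint xs ys
disjoint-by f fxs fys (v∈xs , v∈ys) = not-¬ (All.lookup fxs v∈xs) (All.lookup fys v∈ys)

embed-injective : ∀ {n k} (F : Face n k) {u v} → embed F u ≡ embed F v → u ≡ v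
embed-injective cube        eq = eq
embed-injective (fixed b F) eq = embed-injective F (∷-injectiveʳ eq)
embed-injective (free F) {c ∷ u} {c′ ∷ v} eq =
  cong₂ _∷_ (∷-injectiveˡ eq) (embed-injective F (∷-injectiveʳ eq))

extend₂-unique : ∀ {n} {S : List (Vertex n)} → Unique S → Unique (extend₂ S)
extend₂-unique {n} {S} uS =
  ++⁺ (map⁺ (λ eq → ++-injectiveʳ (zeros 6) (zeros 6) eq) uS)
      (map⁺ (λ {x} {y} → ++-injectiveˡ {ys = zeros n} {zs = zeros n} x y) (from-yes (unique? extra₂)))
      (disjoint-by (λ v → does (take 6 v ≟V zeros 6))
        (All.map⁺ (All.universal (λ _ → refl) S))
        (All.map⁺ {xs = extra₂} {f = _++ zeros n} (refl ∷ refl ∷ refl ∷ [])))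

unique-S₂ : ∀ n → Unique (S₂ n)
unique-S₂ 0 = from-yes (unique? (S₂ 0))
unique-S₂ 1 = from-yes (unique? (S₂ 1))
unique-S₂ 2 = from-yes (unique? (S₂ 2))
unique-S₂ 3 = from-yes (unique? (S₂ 3))
unique-S₂ 4 = from-yes (unique? (S₂ 4))
unique-S₂ 5 = from-yes (unique? (S₂ 5))
unique-S₂ 6 = from-yes (unique? (S₂ 6))
unique-S₂ 7 = from-yes (unique? (S₂ 7))
unique-S₂ (suc (suc (suc (suc (suc (suc (suc (suc n)))))))) = extend₂-unique (unique-S₂ (suc (suc n)))

E-off-floor : ∀ m → All (λ v → onFloor v ≡ false) (E m)
E-off-floor 0 = from-yes (All.all? (λ v → onFloor v ≟B false) (E 0))
E-off-floor 1 = from-yes (All.all? (λ v → onFloor v ≟B false) (E 1))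
E-off-floor (suc (suc m)) =
  All.++⁺ (All.map⁺ (All.map (λ { {x ∷ y ∷ z ∷ w} off → off }) (E-off-floor m)))
          (All.map⁺ {xs = extra₃} {f = _++ zeros (3 + m)} (refl ∷ refl ∷ []))

unique-E : ∀ m → Unique (E m)
unique-E 0 = from-yes (unique? (E 0))
unique-E 1 = from-yes (unique? (E 1))
unique-E (suc (suc m)) =
  ++⁺ (map⁺ (embed-injective zeros₃₄) (unique-E m))
      (map⁺ (λ {x} {y} → ++-injectiveˡ {ys = zeros (3 + m)} {zs = zeros (3 + m)} x y) (from-yes (unique? extra₃)))
      (disjoint-by (λ v → lookup v (# 3))
        (All.map⁺ (All.universal (λ { (x ∷ y ∷ z ∷ w) → refl }) (E m)))
        (All.map⁺ {xs = extra₃} {f = _++ zeros (3 + m)} (refl ∷ refl ∷ [])))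

extend₃-unique : ∀ {m} {S : List (Vertex (3 + m))} → Unique S → Unique (extend₃ S)
extend₃-unique {m} {S} uS =
  ++⁺ (map⁺ (λ eq → ++-injectiveʳ (zeros 3) (zeros 3) eq) uS) (unique-E m)
      (disjoint-by onFloor (All.map⁺ (All.universal (λ _ → refl) S)) (E-off-floor m))

unique-S₃ : ∀ m → Unique (S₃ m)
unique-S₃ 0 = from-yes (unique? (S₃ 0))
unique-S₃ 1 = from-yes (unique? (S₃ 1))
unique-S₃ 2 = from-yes (unique? (S₃ 2))
unique-S₃ (suc (suc (suc m))) = extend₃-unique (unique-S₃ m)

lemma3p1 : (d : ℕ) → 3 ≤ d →
    Σ (List (Vertex d)) λ S₁ → Σ (List (Vertex d)) λ S₂ → Σ (List (Vertex d)) λ S₃ →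
      (Unique S₁ × Unique S₂ × Unique S₃)
      × (S₁ ⊆ S₂ × S₂ ⊆ S₃)
      × length S₁ ≡ 1
      × length S₂ ≡ (d + 1) / 2 + 1
      × length S₃ ≡ (d * (d + 3) + 5) / 6 + 1
      × (Percolates 1 (toVSet S₁) × Percolates 2 (toVSet S₂) × Percolates 3 (toVSet S₃))
lemma3p1 (suc (suc (suc m))) (s≤s (s≤s (s≤s z≤n))) =
  zeros d ∷ [] , S₂ d , S₃ m ,
  ([] ∷ [] , unique-S₂ d , unique-S₃ m) ,
  ((λ { (here refl) → zeros∈S₂ d }) , S₂⊆S₃ m) ,
  refl , length-S₂ d , length-S₃ m ,
  (zeros-percolates₁ d , S₂-percolates d , S₃-percolates m)
  where d = 3 + m
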